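{- Let $N_0(x)=1$ and $N_{n+1}(x)=(2n+1)xN_n(x)+2x(1-x)N_n'(x)$ for $n\ge0$, and let $A_n(x)$ be the Eulerian polynomials. Then for every $n\ge0$, $$\sum_{k=0}^n\binom{n}{k}N_k(x)N_{n-k}(x)=2^nA_n(x).$$
   Context: The Eulerian polynomials are $A_0(x)=1$ and $A_n(x)=\sum_{\pi\in S_n}x^{\mathrm{des}(\pi)+1}$ for $n\ge1$, where $\mathrm{des}(\pi)$ is the number of $i\in\{1,\dots,n-1\}$ with $\pi(i)>\pi(i+1)$; equivalently $1+\sum_{n\ge1}A_n(x)t^n/n!=\frac{1-x}{1-xe^{t(1-x)}}$. (The polynomial $N_n(x)=\sum_k N(n,k)x^k$ is the generating polynomial of the coefficients in $(y\,d/dx)^n(\sec x)=\sum_k N(n,k)\tan^{2k}x\sec^{2n-2k+1}x$.) -}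

module Defs where

open import Data.Nat as ℕ using (ℕ; zero; suc; _<ᵇ_; _≡ᵇ_)
open import Data.Nat.Combinatorics using (_C_)
open import Data.Integer as ℤ using (ℤ; +_; _+_; _*_; _-_; 0ℤ; 1ℤ)
open import Data.Bool using (Bool; true; false; if_then_else_; _∧_; not)
open import Data.Fin using (Fin; toℕ)
open import Data.Vec using (Vec; []; _∷_; toList)
open import Data.List as List using (List; []; _∷_; concatMap; map; filter; length)
open import Data.Bool.ListAction using (any)
open import Relation.Nullary.Decidable using (does)

-- Polynomials with integer coefficients, represented by their coefficient
-- sequence: p k is the coefficient of x^k (only finitely many are nonzero
-- for the polynomials defined below).
Poly : Set
Poly = ℕ → ℤ

sumTo : ℕ → (ℕ → ℤ) → ℤ
sumTo zero    f = f 0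
sumTo (suc n) f = sumTo n f + f (suc n)

xmul : Poly → Poly
xmul p zero    = 0ℤ
xmul p (suc k) = p k

deriv : Poly → Poly
deriv p k = + (suc k) * p (suc k)

scale : ℤ → Poly → Poly
scale c p k = c * p k

_⊕_ : Poly → Poly → Poly
(p ⊕ q) k = p k + q k

_⊖_ : Poly → Poly → Poly
(p ⊖ q) k = p k - q k

_⊗_ : Poly → Poly → Poly
(p ⊗ q) k = sumTo k (λ i → p i * q (k ℕ.∸ i))

one : Poly
one zero    = 1ℤ
one (suc k) = 0ℤ

-- N_0 = 1,  N_{n+1} = (2n+1) x N_n + 2x(1-x) N_n'
--                   = (2n+1) x N_n + 2 x N_n' - 2 x^2 N_n'
Npoly : ℕ → Poly
Npoly zero    = one
Npoly (suc n) =
  (scale (+ (2 ℕ.* n ℕ.+ 1)) (xmul (Npoly n))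
    ⊕ scale (+ 2) (xmul (deriv (Npoly n))))
    ⊖ scale (+ 2) (xmul (xmul (deriv (Npoly n))))

allWords : (m n : ℕ) → List (Vec (Fin n) m)
allWords zero    n = [] ∷ []
allWords (suc m) n =
  concatMap (λ w → map (λ i → i ∷ w) (List.allFin n)) (allWords m n)

distinct : List ℕ → Bool
distinct []       = true
distinct (a ∷ as) = not (any (λ b → a ≡ᵇ b) as) ∧ distinct as

-- S_n: the permutations of {0,…,n-1}, in one-line notation
-- (a word of length n over Fin n with distinct letters)
perms : (n : ℕ) → List (Vec (Fin n) n)
perms n = filter (λ w → distinct (map toℕ (toList w)) Data.Bool.≟ true) (allWords n n)
  where import Data.Bool

desList : List ℕ → ℕ
desList []           = 0
desList (a ∷ [])     = 0
desList (a ∷ b ∷ as) = (if b <ᵇ a then 1 else 0) ℕ.+ desList (b ∷ as)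

des : ∀ {n} → Vec (Fin n) n → ℕ
des w = desList (map toℕ (toList w))

-- Eulerian polynomials: A_0 = 1, A_n(x) = Σ_{π ∈ S_n} x^{des(π)+1} (n ≥ 1);
-- coefficient of x^k is #{π ∈ S_n : des(π)+1 = k}.
Eulerian : ℕ → Poly
Eulerian zero    = one
Eulerian (suc n) k =
  + length (filter (λ w → (des w ℕ.+ 1) ℕ.≟ k) (perms (suc n)))

lhsPoly : ℕ → Poly
lhsPoly n d = sumTo n (λ k → + (n C k) * (Npoly k ⊗ Npoly (n ℕ.∸ k)) d)

module Submission where

open import Defs
open import Data.Nat using (ℕ; _^_)
open import Data.Integer using (+_; _*_)
open import Relation.Binary.PropositionalEquality using (_≡_)

-- Both sides satisfy  P_{n+1} = R_{2(n+1)} P_n  for the operator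
-- R_c p = c x p + 2x(1−x) p',  and both equal 1 for n = 0.
-- Left side: N_{n+1} = R_{2n+1} N_n by definition, and the Leibniz rule gives
-- the product rule  (R_a p) q + p (R_b q) = R_{a+b} (p q).  Pascal's rule splits
-- the convolution for n+1 into pairs N_{k+1} N_{n−k} + N_k N_{n+1−k}, each equal
-- to R_{2(n+1)} (N_k N_{n−k}); linearity of R then gives the recurrence.
-- Right side: it amounts to  A_{n+1} = (n+1) x A_n + x(1−x) A_n',  proved by
-- counting.  A word with distinct letters from {0,…,n} either avoids the least
-- letter 0 or arises by inserting 0 into a word over {1,…,n}; inserting 0 into
-- a word of length m with d descents gives d+1 words with d descents and m−d
-- with d+1.  So such words of length m with k−1 descents number C(n,m)·e m k,
-- with e the Eulerian numbers, and the permutations of Defs are the case m = n.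

module IntegerSums where
  open import Data.Nat using (zero; suc; _≤_; z≤n)
  import Data.Nat.Properties as ℕP
  open import Data.Integer using (ℤ; 0ℤ; _+_; _-_)
  open import Data.Integer.Tactic.RingSolver using (solve-∀)
  open import Relation.Binary.PropositionalEquality using (refl; trans; cong; cong₂)

  sumTo-cong : ∀ n {f g : ℕ → ℤ} → (∀ i → i ≤ n → f i ≡ g i) → sumTo n f ≡ sumTo n g
  sumTo-cong zero    f≡g = f≡g 0 z≤n
  sumTo-cong (suc n) f≡g =
    cong₂ _+_ (sumTo-cong n (λ i i≤n → f≡g i (ℕP.m≤n⇒m≤1+n i≤n))) (f≡g (suc n) ℕP.≤-refl)

  sumTo-+ : ∀ n (f g : ℕ → ℤ) → sumTo n (λ i → f i + g i) ≡ sumTo n f + sumTo n g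
  sumTo-+ zero    f g = refl
  sumTo-+ (suc n) f g =
    trans (cong (_+ (f (suc n) + g (suc n))) (sumTo-+ n f g))
          (interchange (sumTo n f) (sumTo n g) (f (suc n)) (g (suc n)))
    where
    interchange : ∀ a b c d → (a + b) + (c + d) ≡ (a + c) + (b + d)
    interchange = solve-∀

  sumTo-- : ∀ n (f g : ℕ → ℤ) → sumTo n (λ i → f i - g i) ≡ sumTo n f - sumTo n g
  sumTo-- zero    f g = refl
  sumTo-- (suc n) f g =
    trans (cong (_+ (f (suc n) - g (suc n))) (sumTo-- n f g))
          (interchange (sumTo n f) (sumTo n g) (f (suc n)) (g (suc n)))
    where
    interchange : ∀ a b c d → (a - b) + (c - d) ≡ (a + c) - (b + d)
    interchange = solve-∀

  sumTo-* : ∀ n c (f : ℕ → ℤ) → sumTo n (λ i → c * f i) ≡ c * sumTo n f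
  sumTo-* zero    c f = refl
  sumTo-* (suc n) c f =
    trans (cong (_+ c * f (suc n)) (sumTo-* n c f)) (factor c (sumTo n f) (f (suc n)))
    where
    factor : ∀ c a b → c * a + c * b ≡ c * (a + b)
    factor = solve-∀

  sumTo-head : ∀ n (f : ℕ → ℤ) → sumTo (suc n) f ≡ f 0 + sumTo n (λ i → f (suc i))
  sumTo-head zero    f = refl
  sumTo-head (suc n) f =
    trans (cong (_+ f (suc (suc n))) (sumTo-head n f))
          (assoc (f 0) (sumTo n (λ i → f (suc i))) (f (suc (suc n))))
    where
    assoc : ∀ a b c → (a + b) + c ≡ a + (b + c)
    assoc = solve-∀

  sumTo-zero : ∀ n (f : ℕ → ℤ) → (∀ i → i ≤ n → f i ≡ 0ℤ) → sumTo n f ≡ 0ℤ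
  sumTo-zero n f f≡0 = trans (sumTo-cong n f≡0) (vanish n)
    where
    vanish : ∀ n → sumTo n (λ _ → 0ℤ) ≡ 0ℤ
    vanish zero    = refl
    vanish (suc n) = cong (_+ 0ℤ) (vanish n)

module PolynomialAlgebra where
  open import Data.Nat using (zero; suc; _∸_; _≤_)
  import Data.Nat.Properties as ℕP
  open import Data.Integer using (ℤ; 1ℤ; _+_; _-_)
  import Data.Integer.Properties as ℤP
  open import Data.Integer.Tactic.RingSolver using (solve-∀)
  open import Relation.Binary.PropositionalEquality using (refl; sym; trans; cong; cong₂; module ≡-Reasoning)
  open IntegerSums

  xmul-cong : ∀ {f g : Poly} → (∀ k → f k ≡ g k) → ∀ d → xmul f d ≡ xmul g d
  xmul-cong f≗g zero    = refl
  xmul-cong f≗g (suc d) = f≗g d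

  record XLinear (L : Poly → Poly) : Set where
    field
      map-⊕     : ∀ f g d → L (f ⊕ g) d ≡ L f d + L g d
      map-⊖     : ∀ f g d → L (f ⊖ g) d ≡ L f d - L g d
      map-scale : ∀ c f d → L (scale c f) d ≡ c * L f d
      map-xmul  : ∀ f d → L (xmul f) d ≡ xmul (L f) d

  ⊗-linearˡ : ∀ q → XLinear (_⊗ q)
  ⊗-linearˡ q = record
    { map-⊕     = λ f g d → trans (sumTo-cong d (λ i _ → distribʳ-+ (f i) (g i) _)) (sumTo-+ d _ _)
    ; map-⊖     = λ f g d → trans (sumTo-cong d (λ i _ → distribʳ-- (f i) (g i) _)) (sumTo-- d _ _)
    ; map-scale = λ c f d → trans (sumTo-cong d (λ i _ → ℤP.*-assoc c (f i) _)) (sumTo-* d c _)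
    ; map-xmul  = xmul-⊗
    }
    where
    distribʳ-+ : ∀ a b c → (a + b) * c ≡ a * c + b * c
    distribʳ-+ = solve-∀
    distribʳ-- : ∀ a b c → (a - b) * c ≡ a * c - b * c
    distribʳ-- = solve-∀
    -- the i = 0 summand of (x·f) ⊗ q vanishes; the others are those of f ⊗ q
    xmul-⊗ : ∀ f d → (xmul f ⊗ q) d ≡ xmul (f ⊗ q) d
    xmul-⊗ f zero    = refl
    xmul-⊗ f (suc d) = trans (sumTo-head d _) (ℤP.+-identityˡ _)

  ⊗-linearʳ : ∀ p → XLinear (p ⊗_)
  ⊗-linearʳ p = record
    { map-⊕     = λ f g d → trans (sumTo-cong d (λ i _ → ℤP.*-distribˡ-+ (p i) (f (d ∸ i)) _))
                                  (sumTo-+ d _ _)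
    ; map-⊖     = λ f g d → trans (sumTo-cong d (λ i _ → distribˡ-- (p i) (f (d ∸ i)) _)) (sumTo-- d _ _)
    ; map-scale = λ c f d → trans (sumTo-cong d (λ i _ → swap (p i) c _)) (sumTo-* d c _)
    ; map-xmul  = ⊗-xmul
    }
    where
    distribˡ-- : ∀ a b c → a * (b - c) ≡ a * b - a * c
    distribˡ-- = solve-∀
    swap : ∀ a b c → a * (b * c) ≡ b * (a * c)
    swap = solve-∀
    -- the i = d summand of p ⊗ (x·f) vanishes; the others are those of p ⊗ f
    ⊗-xmul : ∀ f d → (p ⊗ xmul f) d ≡ xmul (p ⊗ f) d
    ⊗-xmul f zero    = ℤP.*-zeroʳ (p 0)
    ⊗-xmul f (suc d) rewrite ℕP.n∸n≡0 d | ℤP.*-zeroʳ (p (suc d)) =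
      trans (ℤP.+-identityʳ _)
            (sumTo-cong d (λ i i≤d → cong (λ j → p i * xmul f j) (ℕP.+-∸-assoc 1 i≤d)))

  ⊗-identityˡ : ∀ q d → (one ⊗ q) d ≡ q d
  ⊗-identityˡ q zero    = ℤP.*-identityˡ (q 0)
  ⊗-identityˡ q (suc d) =
    trans (sumTo-head d _)
          (trans (cong (λ z → 1ℤ * q (suc d) + z) (sumTo-zero d _ (λ _ _ → refl)))
                 (trans (ℤP.+-identityʳ _) (ℤP.*-identityˡ (q (suc d)))))

  leibniz : ∀ p q d → (deriv p ⊗ q) d + (p ⊗ deriv q) d ≡ deriv (p ⊗ q) d
  leibniz p q d = begin
      (deriv p ⊗ q) d + (p ⊗ deriv q) d
    ≡⟨ cong₂ _+_ derivˡ derivʳ ⟩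
      sumTo (suc d) (λ i → + i * t i) + sumTo (suc d) (λ i → + (suc d ∸ i) * t i)
    ≡⟨ sym (sumTo-+ (suc d) _ _) ⟩
      sumTo (suc d) (λ i → + i * t i + + (suc d ∸ i) * t i)
    ≡⟨ sumTo-cong (suc d) weights ⟩
      sumTo (suc d) (λ i → + suc d * t i)
    ≡⟨ sumTo-* (suc d) (+ suc d) t ⟩
      deriv (p ⊗ q) d ∎
    where
    open ≡-Reasoning
    t : ℕ → ℤ
    t i = p i * q (suc d ∸ i)
    swap : ∀ a b c → a * (b * c) ≡ b * (a * c)
    swap = solve-∀
    derivˡ : (deriv p ⊗ q) d ≡ sumTo (suc d) (λ i → + i * t i)
    derivˡ = sym (trans (sumTo-head d (λ i → + i * t i)) (trans (ℤP.+-identityˡ _)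
               (sumTo-cong d (λ i _ → sym (ℤP.*-assoc (+ suc i) (p (suc i)) (q (d ∸ i)))))))
    derivʳ : (p ⊗ deriv q) d ≡ sumTo (suc d) (λ i → + (suc d ∸ i) * t i)
    derivʳ = sym (trans (cong (λ z → sumTo d (λ i → + (suc d ∸ i) * t i) + + z * t (suc d)) (ℕP.n∸n≡0 d))
                 (trans (ℤP.+-identityʳ _)
                 (sumTo-cong d (λ i i≤d → trans (cong (λ j → + j * (p i * q j)) (ℕP.+-∸-assoc 1 i≤d))
                                                (swap (+ suc (d ∸ i)) (p i) (q (suc (d ∸ i))))))))
    weights : ∀ i → i ≤ suc d → + i * t i + + (suc d ∸ i) * t i ≡ + suc d * t i
    weights i i≤d = trans (sym (ℤP.*-distribʳ-+ (t i) (+ i) (+ (suc d ∸ i))))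
                          (cong (_* t i) (trans (sym (ℤP.pos-+ i (suc d ∸ i)))
                                                (cong +_ (ℕP.m+[n∸m]≡n i≤d))))

-- The operator driving both recurrences,
--   R_c p = c x p + 2x(1−x) p',   so that   N_{n+1} = R_{2n+1} N_n.
-- It is written through the shape  S a u v = a x u + 2x v − 2x² v,  R_c p = S c p p'.
module RecurrenceOperator where
  open import Data.Nat using (zero; suc)
  open import Data.Integer using (ℤ; 0ℤ; _+_; _-_)
  import Data.Integer.Properties as ℤP
  open import Data.Integer.Tactic.RingSolver using (solve-∀)
  open import Relation.Binary.PropositionalEquality using (refl; sym; trans; cong; cong₂; module ≡-Reasoning)
  open IntegerSums
  open PolynomialAlgebra

  S : ℤ → Poly → Poly → Poly
  S a u v = (scale a (xmul u) ⊕ scale (+ 2) (xmul v)) ⊖ scale (+ 2) (xmul (xmul v))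

  R : ℤ → Poly → Poly
  R c p = S c p (deriv p)

  R-zero : ∀ c f → R c f 0 ≡ 0ℤ
  R-zero c f = vanish c
    where
    vanish : ∀ c → (c * 0ℤ + + 2 * 0ℤ) - + 2 * 0ℤ ≡ 0ℤ
    vanish = solve-∀

  R-suc : ∀ c f j → R c f (suc j) ≡ (c * f j + + 2 * (+ suc j * f (suc j))) - + 2 * (+ j * f j)
  R-suc c f zero    = refl
  R-suc c f (suc j) = refl

  R-cong : ∀ c {f g : Poly} → (∀ k → f k ≡ g k) → ∀ d → R c f d ≡ R c g d
  R-cong c {f} {g} f≗g zero    = trans (R-zero c f) (sym (R-zero c g))
  R-cong c {f} {g} f≗g (suc j) rewrite R-suc c f j | R-suc c g j | f≗g j | f≗g (suc j) = refl

  R-sum : ∀ n (w : ℕ → ℤ) (P : ℕ → Poly) c d →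
    sumTo n (λ k → w k * R c (P k) d) ≡ R c (λ e → sumTo n (λ k → w k * P k e)) d
  R-sum n w P c zero =
    trans (sumTo-zero n _ (λ k _ → trans (cong (w k *_) (R-zero c (P k))) (ℤP.*-zeroʳ (w k))))
          (sym (R-zero c (λ e → sumTo n (λ k → w k * P k e))))
  R-sum n w P c (suc j) = begin
      sumTo n (λ k → w k * R c (P k) (suc j))
    ≡⟨ sumTo-cong n (λ k _ → trans (cong (w k *_) (R-suc c (P k) j))
                                    (spread c (+ suc j) (+ j) (w k) (P k j) (P k (suc j)))) ⟩
      sumTo n (λ k → (c * (w k * P k j) + (+ 2 * + suc j) * (w k * P k (suc j))) - (+ 2 * + j) * (w k * P k j))
    ≡⟨ sumTo-- n _ _ ⟩
      sumTo n (λ k → c * (w k * P k j) + (+ 2 * + suc j) * (w k * P k (suc j)))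
        - sumTo n (λ k → (+ 2 * + j) * (w k * P k j))
    ≡⟨ cong₂ _-_ (trans (sumTo-+ n _ _) (cong₂ _+_ (sumTo-* n c _) (sumTo-* n (+ 2 * + suc j) _)))
                 (sumTo-* n (+ 2 * + j) _) ⟩
      (c * F j + (+ 2 * + suc j) * F (suc j)) - (+ 2 * + j) * F j
    ≡⟨ regroup c (+ suc j) (+ j) (F j) (F (suc j)) ⟩
      (c * F j + + 2 * (+ suc j * F (suc j))) - + 2 * (+ j * F j)
    ≡⟨ sym (R-suc c F j) ⟩
      R c F (suc j) ∎
    where
    open ≡-Reasoning
    F : Poly
    F e = sumTo n (λ k → w k * P k e)
    spread : ∀ c s t w A B → w * ((c * A + + 2 * (s * B)) - + 2 * (t * A))
                             ≡ (c * (w * A) + (+ 2 * s) * (w * B)) - (+ 2 * t) * (w * A)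
    spread = solve-∀
    regroup : ∀ c s t A B → (c * A + (+ 2 * s) * B) - (+ 2 * t) * A ≡ (c * A + + 2 * (s * B)) - + 2 * (t * A)
    regroup = solve-∀

  R-scale : ∀ a c f d → a * R c f d ≡ R c (λ j → a * f j) d
  R-scale a c f d = R-sum 0 (λ _ → a) (λ _ → f) c d

  S-map : ∀ {L} → XLinear L → ∀ a u v d → L (S a u v) d ≡ S a (L u) (L v) d
  S-map {L} lin a u v d = begin
      L (S a u v) d
    ≡⟨ map-⊖ _ _ d ⟩
      L (scale a (xmul u) ⊕ scale (+ 2) (xmul v)) d - L (scale (+ 2) (xmul (xmul v))) d
    ≡⟨ cong₂ _-_ (map-⊕ _ _ d) (map-scale (+ 2) _ d) ⟩
      (L (scale a (xmul u)) d + L (scale (+ 2) (xmul v)) d) - + 2 * L (xmul (xmul v)) d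
    ≡⟨ cong₂ _-_ (cong₂ _+_ (map-scale a _ d) (map-scale (+ 2) _ d)) refl ⟩
      (a * L (xmul u) d + + 2 * L (xmul v) d) - + 2 * L (xmul (xmul v)) d
    ≡⟨ cong₂ _-_ (cong₂ _+_ (cong (a *_) (map-xmul u d)) (cong (+ 2 *_) (map-xmul v d)))
                 (cong (+ 2 *_) (trans (map-xmul (xmul v) d) (xmul-cong (map-xmul v) d))) ⟩
      S a (L u) (L v) d ∎
    where
    open ≡-Reasoning
    open XLinear lin

  collectS : ∀ a b U V W X Y → ((a * U + + 2 * V) - + 2 * X) + ((b * U + + 2 * W) - + 2 * Y)
                               ≡ ((a + b) * U + + 2 * (V + W)) - + 2 * (X + Y)
  collectS = solve-∀

  S-+ : ∀ a b u v w d → S a u v d + S b u w d ≡ S (a + b) u (v ⊕ w) d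
  S-+ a b u v w zero          = collectS a b 0ℤ 0ℤ 0ℤ 0ℤ 0ℤ
  S-+ a b u v w (suc zero)    = collectS a b (u 0) (v 0) (w 0) 0ℤ 0ℤ
  S-+ a b u v w (suc (suc k)) = collectS a b (u (suc k)) (v (suc k)) (w (suc k)) (v k) (w k)

  S-congʳ : ∀ a u {v w : Poly} → (∀ k → v k ≡ w k) → ∀ d → S a u v d ≡ S a u w d
  S-congʳ a u v≗w d =
    cong₂ (λ y z → (a * xmul u d + + 2 * y) - + 2 * z) (xmul-cong v≗w d) (xmul-cong (xmul-cong v≗w) d)

  R-leibniz : ∀ a b p q d → (R a p ⊗ q) d + (p ⊗ R b q) d ≡ R (a + b) (p ⊗ q) d
  R-leibniz a b p q d = begin
      (R a p ⊗ q) d + (p ⊗ R b q) d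
    ≡⟨ cong₂ _+_ (S-map (⊗-linearˡ q) a p (deriv p) d) (S-map (⊗-linearʳ p) b q (deriv q) d) ⟩
      S a (p ⊗ q) (deriv p ⊗ q) d + S b (p ⊗ q) (p ⊗ deriv q) d
    ≡⟨ S-+ a b (p ⊗ q) (deriv p ⊗ q) (p ⊗ deriv q) d ⟩
      S (a + b) (p ⊗ q) ((deriv p ⊗ q) ⊕ (p ⊗ deriv q)) d
    ≡⟨ S-congʳ (a + b) (p ⊗ q) (leibniz p q) d ⟩
      R (a + b) (p ⊗ q) d ∎
    where open ≡-Reasoning

module ConvolutionRecurrence where
  open import Data.Nat as ℕ using (suc; _∸_; _≤_)
  import Data.Nat.Properties as ℕP
  open import Data.Nat.Combinatorics using (_C_; nCk+nC[k+1]≡[n+1]C[k+1]; k>n⇒nCk≡0)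
  open import Data.Integer using (ℤ; _+_)
  import Data.Integer.Properties as ℤP
  open import Data.Integer.Tactic.RingSolver using (solve-∀)
  import Data.Nat.Tactic.RingSolver as ℕSolver
  open import Relation.Binary.PropositionalEquality using (sym; trans; cong; module ≡-Reasoning)
  open IntegerSums
  open RecurrenceOperator

  pascal-sum : ∀ n (g : ℕ → ℕ → ℤ) →
    sumTo (suc n) (λ k → + (suc n C k) * g k (suc n ∸ k)) ≡
    sumTo n (λ k → + (n C k) * (g (suc k) (n ∸ k) + g k (suc n ∸ k)))
  pascal-sum n g = begin
      sumTo (suc n) (λ k → + (suc n C k) * g k (suc n ∸ k))
    ≡⟨ sumTo-head n _ ⟩
      first + sumTo n (λ j → + (suc n C suc j) * g (suc j) (n ∸ j))
    ≡⟨ cong (λ z → first + z) (trans (sumTo-cong n (λ j _ → pascal j)) (sumTo-+ n _ _)) ⟩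
      first + (lower + upper)
    ≡⟨ rotate first lower upper ⟩
      lower + (first + upper)
    ≡⟨ cong (λ z → lower + z) (sym (sumTo-head n (λ k → + (n C k) * g k (suc n ∸ k)))) ⟩
      lower + sumTo (suc n) (λ k → + (n C k) * g k (suc n ∸ k))
    ≡⟨ cong (λ z → lower + z) dropTop ⟩
      lower + sumTo n (λ k → + (n C k) * g k (suc n ∸ k))
    ≡⟨ sym (sumTo-+ n _ _) ⟩
      sumTo n (λ k → + (n C k) * g (suc k) (n ∸ k) + + (n C k) * g k (suc n ∸ k))
    ≡⟨ sumTo-cong n (λ k _ → sym (ℤP.*-distribˡ-+ (+ (n C k)) _ _)) ⟩
      sumTo n (λ k → + (n C k) * (g (suc k) (n ∸ k) + g k (suc n ∸ k))) ∎
    where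
    open ≡-Reasoning
    first lower upper : ℤ
    first = + 1 * g 0 (suc n)
    lower = sumTo n (λ j → + (n C j) * g (suc j) (n ∸ j))
    upper = sumTo n (λ j → + (n C suc j) * g (suc j) (n ∸ j))
    pascal : ∀ j → + (suc n C suc j) * g (suc j) (n ∸ j)
                   ≡ + (n C j) * g (suc j) (n ∸ j) + + (n C suc j) * g (suc j) (n ∸ j)
    pascal j = trans (cong (λ c → + c * g (suc j) (n ∸ j)) (sym (nCk+nC[k+1]≡[n+1]C[k+1] n j)))
               (trans (cong (_* g (suc j) (n ∸ j)) (ℤP.pos-+ (n C j) (n C suc j)))
                      (ℤP.*-distribʳ-+ (g (suc j) (n ∸ j)) (+ (n C j)) (+ (n C suc j))))
    rotate : ∀ a b c → a + (b + c) ≡ b + (a + c)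
    rotate = solve-∀
    -- the summand k = n+1 carries C(n, n+1) = 0
    dropTop : sumTo (suc n) (λ k → + (n C k) * g k (suc n ∸ k))
              ≡ sumTo n (λ k → + (n C k) * g k (suc n ∸ k))
    dropTop = trans (cong (λ c → sumTo n (λ k → + (n C k) * g k (suc n ∸ k)) + + c * g (suc n) (n ∸ n))
                          (k>n⇒nCk≡0 (ℕP.n<1+n n)))
                    (ℤP.+-identityʳ _)

  -- (2k+1) + (2(n−k)+1) = 2(n+1): the operator indices of N_k and N_{n−k} add up
  index-sum : ∀ n k → k ≤ n → + (2 ℕ.* k ℕ.+ 1) + + (2 ℕ.* (n ∸ k) ℕ.+ 1) ≡ + (2 ℕ.* suc n)
  index-sum n k k≤n = trans (sym (ℤP.pos-+ (2 ℕ.* k ℕ.+ 1) (2 ℕ.* (n ∸ k) ℕ.+ 1)))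
                            (cong +_ (trans (collect k (n ∸ k))
                                            (cong (λ m → 2 ℕ.* suc m) (ℕP.m+[n∸m]≡n k≤n))))
    where
    collect : ∀ a b → 2 ℕ.* a ℕ.+ 1 ℕ.+ (2 ℕ.* b ℕ.+ 1) ≡ 2 ℕ.* suc (a ℕ.+ b)
    collect = ℕSolver.solve-∀

  lhs-step : ∀ n d → lhsPoly (suc n) d ≡ R (+ (2 ℕ.* suc n)) (lhsPoly n) d
  lhs-step n d = begin
      lhsPoly (suc n) d
    ≡⟨ pascal-sum n (λ k j → (Npoly k ⊗ Npoly j) d) ⟩
      sumTo n (λ k → + (n C k) * ((Npoly (suc k) ⊗ Npoly (n ∸ k)) d + (Npoly k ⊗ Npoly (suc n ∸ k)) d))
    ≡⟨ sumTo-cong n (λ k k≤n → cong (+ (n C k) *_) (pair-step k k≤n)) ⟩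
      sumTo n (λ k → + (n C k) * R (+ (2 ℕ.* suc n)) (Npoly k ⊗ Npoly (n ∸ k)) d)
    ≡⟨ R-sum n (λ k → + (n C k)) (λ k → Npoly k ⊗ Npoly (n ∸ k)) (+ (2 ℕ.* suc n)) d ⟩
      R (+ (2 ℕ.* suc n)) (lhsPoly n) d ∎
    where
    open ≡-Reasoning
    pair-step : ∀ k → k ≤ n →
      (Npoly (suc k) ⊗ Npoly (n ∸ k)) d + (Npoly k ⊗ Npoly (suc n ∸ k)) d
        ≡ R (+ (2 ℕ.* suc n)) (Npoly k ⊗ Npoly (n ∸ k)) d
    pair-step k k≤n rewrite ℕP.+-∸-assoc 1 k≤n =
      trans (R-leibniz (+ (2 ℕ.* k ℕ.+ 1)) (+ (2 ℕ.* (n ∸ k) ℕ.+ 1)) (Npoly k) (Npoly (n ∸ k)) d)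
            (cong (λ c → R c (Npoly k ⊗ Npoly (n ∸ k)) d) (index-sum n k k≤n))

module WordSums where
  open import Data.Nat using (zero; suc; _+_) renaming (_*_ to _·_)
  import Data.Nat.Properties as ℕP
  open import Data.List using (List; []; _∷_; length)
  open import Data.Nat.Tactic.RingSolver using (solve-∀)
  open import Relation.Binary.PropositionalEquality using (refl; sym; trans; cong; cong₂)

  σ : ℕ → (ℕ → ℕ) → ℕ
  σ zero    g = 0
  σ (suc n) g = g 0 + σ n (λ j → g (suc j))

  σ-cong : ∀ n {f g : ℕ → ℕ} → (∀ j → f j ≡ g j) → σ n f ≡ σ n g
  σ-cong zero    f≗g = refl
  σ-cong (suc n) f≗g = cong₂ _+_ (f≗g 0) (σ-cong n (λ j → f≗g (suc j)))

  σ-+ : ∀ n (f g : ℕ → ℕ) → σ n (λ j → f j + g j) ≡ σ n f + σ n g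
  σ-+ zero    f g = refl
  σ-+ (suc n) f g =
    trans (cong (λ s → f 0 + g 0 + s) (σ-+ n (λ j → f (suc j)) (λ j → g (suc j))))
          (interchange (f 0) (g 0) _ _)
    where
    interchange : ∀ a b c d → a + b + (c + d) ≡ a + c + (b + d)
    interchange = solve-∀

  σ-* : ∀ n c (f : ℕ → ℕ) → σ n (λ j → c · f j) ≡ c · σ n f
  σ-* zero    c f = sym (ℕP.*-zeroʳ c)
  σ-* (suc n) c f =
    trans (cong (λ s → c · f 0 + s) (σ-* n c (λ j → f (suc j)))) (sym (ℕP.*-distribˡ-+ c (f 0) _))

  σ-zero : ∀ n {f : ℕ → ℕ} → (∀ j → f j ≡ 0) → σ n f ≡ 0
  σ-zero zero    f≗0 = refl
  σ-zero (suc n) f≗0 = cong₂ _+_ (f≗0 0) (σ-zero n (λ j → f≗0 (suc j)))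

  -- wsum m n F = Σ F l over the words l of length m with letters < n; a word
  -- of length m+1 is a first letter j < n followed by a word of length m.
  wsum : ℕ → ℕ → (List ℕ → ℕ) → ℕ
  wsum zero    n F = F []
  wsum (suc m) n F = wsum m n (λ l → σ n (λ j → F (j ∷ l)))

  wsum-cong : ∀ m n {F G : List ℕ → ℕ} → (∀ l → length l ≡ m → F l ≡ G l) →
    wsum m n F ≡ wsum m n G
  wsum-cong zero    n F≗G = F≗G [] refl
  wsum-cong (suc m) n F≗G = wsum-cong m n (λ l len → σ-cong n (λ j → F≗G (j ∷ l) (cong suc len)))

  wsum-+ : ∀ m n (F G : List ℕ → ℕ) → wsum m n (λ l → F l + G l) ≡ wsum m n F + wsum m n G
  wsum-+ zero    n F G = refl
  wsum-+ (suc m) n F G =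
    trans (wsum-cong m n (λ l _ → σ-+ n (λ j → F (j ∷ l)) (λ j → G (j ∷ l)))) (wsum-+ m n _ _)

  wsum-* : ∀ m n c (F : List ℕ → ℕ) → wsum m n (λ l → c · F l) ≡ c · wsum m n F
  wsum-* zero    n c F = refl
  wsum-* (suc m) n c F =
    trans (wsum-cong m n (λ l _ → σ-* n c (λ j → F (j ∷ l)))) (wsum-* m n c _)

  wsum-zero : ∀ m n {F : List ℕ → ℕ} → (∀ l → length l ≡ m → F l ≡ 0) → wsum m n F ≡ 0
  wsum-zero zero    n F≗0 = F≗0 [] refl
  wsum-zero (suc m) n F≗0 = wsum-zero m n (λ l len → σ-zero n (λ j → F≗0 (j ∷ l) (cong suc len)))

  wsum-σ : ∀ q m n (G : ℕ → List ℕ → ℕ) →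
    wsum m n (λ l → σ q (λ p → G p l)) ≡ σ q (λ p → wsum m n (G p))
  wsum-σ zero    m n G = wsum-zero m n (λ _ _ → refl)
  wsum-σ (suc q) m n G =
    trans (wsum-+ m n (G 0) (λ l → σ q (λ p → G (suc p) l)))
          (cong (λ s → wsum m n (G 0) + s) (wsum-σ q m n (λ p → G (suc p))))

module Insertion where
  open import Data.Nat using (zero; suc; _+_; _∸_; _≤_; _≡ᵇ_; _<ᵇ_; z≤n; s≤s) renaming (_*_ to _·_)
  import Data.Nat.Properties as ℕP
  open import Data.Bool using (Bool; true; false; if_then_else_; not; _∧_; _∨_)
  open import Data.Bool.Properties using (∨-zeroʳ)
  open import Data.Bool.ListAction using (any)
  open import Data.List using (List; []; _∷_; map; length)
  open import Data.Nat.Tactic.RingSolver using (solve-∀)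
  open import Relation.Binary.PropositionalEquality using (refl; sym; trans; cong; cong₂; module ≡-Reasoning)
  open WordSums

  [_] : Bool → ℕ
  [ b ] = if b then 1 else 0

  [∧] : ∀ a b → [ a ∧ b ] ≡ [ a ] · [ b ]
  [∧] true  b = sym (ℕP.+-identityʳ [ b ])
  [∧] false b = refl

  occurs : ℕ → List ℕ → Bool
  occurs a l = any (λ b → a ≡ᵇ b) l

  onDistinct : (List ℕ → ℕ) → List ℕ → ℕ
  onDistinct H l = [ distinct l ] · H l

  shift : List ℕ → List ℕ
  shift = map suc

  insert0 : ℕ → List ℕ → List ℕ
  insert0 zero    l       = 0 ∷ l
  insert0 (suc p) []      = 0 ∷ []
  insert0 (suc p) (a ∷ l) = a ∷ insert0 p l

  occurs-shift : ∀ a l → occurs (suc a) (shift l) ≡ occurs a l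
  occurs-shift a []      = refl
  occurs-shift a (b ∷ l) = cong ((a ≡ᵇ b) ∨_) (occurs-shift a l)

  zero-∉-shift : ∀ l → occurs 0 (shift l) ≡ false
  zero-∉-shift []      = refl
  zero-∉-shift (b ∷ l) = zero-∉-shift l

  zero-∈-insert0 : ∀ p l → occurs 0 (insert0 p l) ≡ true
  zero-∈-insert0 zero    l       = refl
  zero-∈-insert0 (suc p) []      = refl
  zero-∈-insert0 (suc p) (b ∷ l) = trans (cong ((0 ≡ᵇ b) ∨_) (zero-∈-insert0 p l)) (∨-zeroʳ (0 ≡ᵇ b))

  occurs-insert0 : ∀ a p l → occurs (suc a) (insert0 p l) ≡ occurs (suc a) l
  occurs-insert0 a zero    l       = refl
  occurs-insert0 a (suc p) []      = refl
  occurs-insert0 a (suc p) (b ∷ l) = cong ((suc a ≡ᵇ b) ∨_) (occurs-insert0 a p l)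

  distinct-shift : ∀ l → distinct (shift l) ≡ distinct l
  distinct-shift []      = refl
  distinct-shift (a ∷ l) = cong₂ (λ o d → not o ∧ d) (occurs-shift a l) (distinct-shift l)

  distinct-insert0 : ∀ p l → distinct (insert0 p (shift l)) ≡ distinct l
  distinct-insert0 zero    l       =
    trans (cong (λ o → not o ∧ distinct (shift l)) (zero-∉-shift l)) (distinct-shift l)
  distinct-insert0 (suc p) []      = refl
  distinct-insert0 (suc p) (a ∷ l) =
    cong₂ (λ o d → not o ∧ d) (trans (occurs-insert0 a p (shift l)) (occurs-shift a l)) (distinct-insert0 p l)

  des-shift : ∀ l → desList (shift l) ≡ desList l
  des-shift []          = refl
  des-shift (a ∷ [])    = refl
  des-shift (a ∷ b ∷ l) = cong (λ d → [ b <ᵇ a ] + d) (des-shift (b ∷ l))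

  des-bound : ∀ a l → desList (a ∷ l) ≤ length l
  des-bound a []      = z≤n
  des-bound a (b ∷ l) = ℕP.+-mono-≤ (bracket≤1 (b <ᵇ a)) (des-bound b l)
    where
    bracket≤1 : ∀ c → [ c ] ≤ 1
    bracket≤1 true  = s≤s z≤n
    bracket≤1 false = z≤n

  -- Inserting 0 into shift (a ∷ l) at the positions 1,…,|a∷l|, i.e. after
  -- some letter: with d = des(a∷l), the d insertions inside a descent keep
  -- d descents, the remaining |a∷l| − d (inside an ascent or at the end)
  -- create one more.
  insert-after-letter : ∀ (φ : ℕ → ℕ) a l →
    σ (length (a ∷ l)) (λ p → φ (desList (insert0 (suc p) (shift (a ∷ l)))))
      ≡ desList (a ∷ l) · φ (desList (a ∷ l))
        + (length (a ∷ l) ∸ desList (a ∷ l)) · φ (suc (desList (a ∷ l)))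
  insert-after-letter φ a []      = refl
  insert-after-letter φ a (b ∷ l) =
    trans (cong₂ _+_ (cong (λ d → φ (suc d)) (des-shift (b ∷ l)))
                     (insert-after-letter (λ x → φ ([ b <ᵇ a ] + x)) b l))
          (first-pair (b <ᵇ a))
    where
    d = desList (b ∷ l)
    L = length l
    -- c tells whether (a, b) is a descent; inserting 0 between a and b
    -- always yields the descent a > 0 followed by the ascent 0 < b.
    first-pair : ∀ c →
      φ (suc d) + (d · φ ([ c ] + d) + (suc L ∸ d) · φ ([ c ] + suc d))
        ≡ ([ c ] + d) · φ ([ c ] + d) + (suc (suc L) ∸ ([ c ] + d)) · φ (suc ([ c ] + d))
    first-pair false rewrite ℕP.+-∸-assoc 1 (ℕP.m≤n⇒m≤1+n (des-bound b l)) =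
      move (φ (suc d)) (d · φ d) (suc L ∸ d)
      where
      move : ∀ x y u → x + (y + u · x) ≡ y + suc u · x
      move = solve-∀
    first-pair true = absorb (φ (suc d)) d ((suc L ∸ d) · φ (suc (suc d)))
      where
      absorb : ∀ x y z → x + (y · x + z) ≡ suc y · x + z
      absorb = solve-∀

  -- Inserting 0 at each of the |l|+1 positions of shift l: des(l)+1 of the
  -- results (front or inside a descent) have des(l) descents, the other
  -- |l| − des(l) have des(l)+1.
  insert-descents : ∀ (φ : ℕ → ℕ) l →
    σ (suc (length l)) (λ p → φ (desList (insert0 p (shift l))))
      ≡ suc (desList l) · φ (desList l) + (length l ∸ desList l) · φ (suc (desList l))
  insert-descents φ []      = sym (ℕP.+-identityʳ (φ 0 + 0))
  insert-descents φ (a ∷ l) =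
    trans (cong₂ _+_ (cong φ (des-shift (a ∷ l))) (insert-after-letter φ a l))
          (absorb (φ (desList (a ∷ l))) (desList (a ∷ l)) _)
    where
    absorb : ∀ x y z → x + (y · x + z) ≡ suc y · x + z
    absorb = solve-∀

  prefixed : ℕ → (List ℕ → ℕ) → List ℕ → ℕ
  prefixed a H l = [ not (occurs a l) ] · H (a ∷ l)

  onDistinct-∷ : ∀ a H l → onDistinct H (a ∷ l) ≡ onDistinct (prefixed a H) l
  onDistinct-∷ a H l =
    trans (cong (_· H (a ∷ l)) ([∧] (not (occurs a l)) (distinct l)))
          (swap [ not (occurs a l) ] [ distinct l ] (H (a ∷ l)))
    where
    swap : ∀ x y z → (x · y) · z ≡ y · (x · z)
    swap = solve-∀

  prefixedPositive : ℕ → (List ℕ → ℕ) → List ℕ → ℕ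
  prefixedPositive n H l = σ n (λ j → prefixed (suc j) H l)

  onDistinct-positive : ∀ n H l →
    σ n (λ j → onDistinct H (suc j ∷ l)) ≡ onDistinct (prefixedPositive n H) l
  onDistinct-positive n H l =
    trans (σ-cong n (λ j → onDistinct-∷ (suc j) H l)) (σ-* n [ distinct l ] (λ j → prefixed (suc j) H l))

  -- Words of length m+1 over {0,…,n} with distinct letters: either 0 does not
  -- occur (the word is shift l for a word l over {0,…,n−1}), or it occurs
  -- exactly once, inserted at some position p ≤ m into such a shifted word.
  split-zero : ∀ m n (H : List ℕ → ℕ) →
    wsum (suc m) (suc n) (onDistinct H)
      ≡ wsum (suc m) n (λ l → onDistinct H (shift l))
        + σ (suc m) (λ p → wsum m n (λ l → onDistinct H (insert0 p (shift l))))
  split-zero zero    n H =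
    trans (ℕP.+-comm (onDistinct H (0 ∷ [])) _)
          (cong (λ s → σ n (λ j → onDistinct H (suc j ∷ [])) + s) (sym (ℕP.+-identityʳ _)))
  split-zero (suc m) n H = begin
      wsum (suc m) (suc n) (λ l → onDistinct H (0 ∷ l) + σ n (λ j → onDistinct H (suc j ∷ l)))
    ≡⟨ wsum-cong (suc m) (suc n) (λ l _ → cong₂ _+_ (onDistinct-∷ 0 H l) (onDistinct-positive n H l)) ⟩
      wsum (suc m) (suc n) (λ l → onDistinct H₀ l + onDistinct H₊ l)
    ≡⟨ wsum-+ (suc m) (suc n) (onDistinct H₀) (onDistinct H₊) ⟩
      wsum (suc m) (suc n) (onDistinct H₀) + wsum (suc m) (suc n) (onDistinct H₊)
    ≡⟨ cong₂ _+_ (split-zero m n H₀) (split-zero m n H₊) ⟩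
      (A₀ + B₀) + (A₊ + B₊)
    ≡⟨ cong (λ b → (A₀ + b) + (A₊ + B₊)) B₀-vanishes ⟩
      (A₀ + 0) + (A₊ + B₊)
    ≡⟨ regroup A₀ A₊ B₊ ⟩
      A₊ + (A₀ + B₊)
    ≡⟨ sym (cong₂ _+_ zero-absent (cong₂ _+_ zero-first zero-later)) ⟩
      wsum (suc (suc m)) n (λ l → onDistinct H (shift l))
        + σ (suc (suc m)) (λ p → wsum (suc m) n (λ l → onDistinct H (insert0 p (shift l)))) ∎
    where
    open ≡-Reasoning
    H₀ H₊ : List ℕ → ℕ
    H₀ = prefixed 0 H
    H₊ = prefixedPositive n H
    A₀ A₊ B₀ B₊ : ℕ
    A₀ = wsum (suc m) n (λ l → onDistinct H₀ (shift l))
    A₊ = wsum (suc m) n (λ l → onDistinct H₊ (shift l))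
    B₀ = σ (suc m) (λ p → wsum m n (λ l → onDistinct H₀ (insert0 p (shift l))))
    B₊ = σ (suc m) (λ p → wsum m n (λ l → onDistinct H₊ (insert0 p (shift l))))
    regroup : ∀ a b c → (a + 0) + (b + c) ≡ b + (a + c)
    regroup = solve-∀
    -- a second 0 cannot be put in front of a word already containing 0
    B₀-vanishes : B₀ ≡ 0
    B₀-vanishes = σ-zero (suc m) (λ p → wsum-zero m n (λ l _ →
      trans (cong (λ o → [ distinct (insert0 p (shift l)) ] · ([ not o ] · H (0 ∷ insert0 p (shift l))))
                  (zero-∈-insert0 p (shift l)))
            (ℕP.*-zeroʳ [ distinct (insert0 p (shift l)) ])))
    zero-absent : wsum (suc (suc m)) n (λ l → onDistinct H (shift l)) ≡ A₊
    zero-absent = wsum-cong (suc m) n (λ l _ → onDistinct-positive n H (shift l))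
    zero-first : wsum (suc m) n (λ l → onDistinct H (0 ∷ shift l)) ≡ A₀
    zero-first = wsum-cong (suc m) n (λ l _ → onDistinct-∷ 0 H (shift l))
    zero-later : σ (suc m) (λ p → wsum (suc m) n (λ l → onDistinct H (insert0 (suc p) (shift l)))) ≡ B₊
    zero-later = σ-cong (suc m) (λ p → wsum-cong m n (λ l _ → onDistinct-positive n H (insert0 p (shift l))))

module DescentCounts where
  open import Data.Nat using (zero; suc; _+_; _∸_; _<_; _≡ᵇ_; s≤s) renaming (_*_ to _·_)
  import Data.Nat.Properties as ℕP
  open import Data.Nat.Combinatorics using (_C_; nCk+nC[k+1]≡[n+1]C[k+1])
  open import Data.Bool using (true; false; T)
  open import Data.Unit using (tt)
  open import Data.List using (List; length)
  open import Data.Nat.Tactic.RingSolver using (solve-∀)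
  open import Relation.Binary.PropositionalEquality using (refl; sym; trans; cong; cong₂; subst; module ≡-Reasoning)
  open WordSums
  open Insertion

  -- Eulerian numbers through their recurrence: for m ≥ 1, e m k = #{π ∈ S_m : des π + 1 = k};
  -- e 0 k = [k = 1] accounts for the empty word, which has no descent.
  e : ℕ → ℕ → ℕ
  e zero    k       = [ 1 ≡ᵇ k ]
  e (suc m) zero    = 0
  e (suc m) (suc k) = suc k · e m (suc k) + (suc m ∸ k) · e m k

  e-vanishes : ∀ m k → suc m < k → e m k ≡ 0
  e-vanishes zero    (suc zero)    (s≤s ())
  e-vanishes zero    (suc (suc k)) _           = refl
  e-vanishes (suc m) (suc k)       (s≤s m+1<k) =
    cong₂ _+_ (trans (cong (suc k ·_) (e-vanishes m (suc k) (ℕP.m<n⇒m<1+n m+1<k))) (ℕP.*-zeroʳ (suc k)))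
              (trans (cong ((suc m ∸ k) ·_) (e-vanishes m k m+1<k)) (ℕP.*-zeroʳ (suc m ∸ k)))

  bracket-at : ∀ (f : ℕ → ℕ) x k → f x · [ x ≡ᵇ k ] ≡ f k · [ x ≡ᵇ k ]
  bracket-at f x k with x ≡ᵇ k in x≡ᵇk
  ... | true  = cong (λ y → f y · 1) (ℕP.≡ᵇ⇒≡ x k (subst T (sym x≡ᵇk) tt))
  ... | false = trans (ℕP.*-zeroʳ (f x)) (sym (ℕP.*-zeroʳ (f k)))

  hasDes : ℕ → List ℕ → ℕ
  hasDes k l = [ desList l + 1 ≡ᵇ k ]

  count : ℕ → ℕ → ℕ → ℕ
  count m n k = wsum m n (onDistinct (hasDes k))

  -- contribution of the insertions that create a new descent
  raised : ℕ → ℕ → ℕ → ℕ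
  raised m n zero    = 0
  raised m n (suc k) = (suc m ∸ k) · count m n k

  -- Eulerian-type recurrence for the counts, from splitting off the letter 0
  -- and inserting it into the words over the remaining letters.
  count-step : ∀ m n k → count (suc m) (suc n) k ≡ count (suc m) n k + (k · count m n k + raised m n k)
  count-step m n k = begin
      count (suc m) (suc n) k
    ≡⟨ split-zero m n (hasDes k) ⟩
      wsum (suc m) n (λ l → onDistinct (hasDes k) (shift l))
        + σ (suc m) (λ p → wsum m n (λ l → onDistinct (hasDes k) (insert0 p (shift l))))
    ≡⟨ cong₂ _+_ (wsum-cong (suc m) n (λ l _ → shift-invariant l))
                 (sym (wsum-σ (suc m) m n (λ p l → onDistinct (hasDes k) (insert0 p (shift l))))) ⟩
      count (suc m) n k + wsum m n (λ l → σ (suc m) (λ p → onDistinct (hasDes k) (insert0 p (shift l))))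
    ≡⟨ cong (λ s → count (suc m) n k + s) (wsum-cong m n insertions) ⟩
      count (suc m) n k + wsum m n (λ l → k · onDistinct (hasDes k) l + new l)
    ≡⟨ cong (λ s → count (suc m) n k + s)
            (trans (wsum-+ m n _ new) (cong₂ _+_ (wsum-* m n k (onDistinct (hasDes k))) (new-total k))) ⟩
      count (suc m) n k + (k · count m n k + raised m n k) ∎
    where
    open ≡-Reasoning
    -- the insertions of 0 that raise the number of descents of l
    new : List ℕ → ℕ
    new l = [ distinct l ] · ((m ∸ desList l) · [ suc (desList l) + 1 ≡ᵇ k ])
    shift-invariant : ∀ l → onDistinct (hasDes k) (shift l) ≡ onDistinct (hasDes k) l
    shift-invariant l = cong₂ (λ b d → [ b ] · [ d + 1 ≡ᵇ k ]) (distinct-shift l) (des-shift l)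
    distribute : ∀ c k x y → c · (k · x + y) ≡ k · (c · x) + c · y
    distribute = solve-∀
    insertions : ∀ l → length l ≡ m →
      σ (suc m) (λ p → onDistinct (hasDes k) (insert0 p (shift l))) ≡ k · onDistinct (hasDes k) l + new l
    insertions l refl = begin
        σ (suc m) (λ p → [ distinct (insert0 p (shift l)) ] · hasDes k (insert0 p (shift l)))
      ≡⟨ σ-cong (suc m) (λ p → cong (λ b → [ b ] · hasDes k (insert0 p (shift l)))
                                    (distinct-insert0 p l)) ⟩
        σ (suc m) (λ p → [ distinct l ] · hasDes k (insert0 p (shift l)))
      ≡⟨ σ-* (suc m) [ distinct l ] (λ p → hasDes k (insert0 p (shift l))) ⟩
        [ distinct l ] · σ (suc m) (λ p → hasDes k (insert0 p (shift l)))
      ≡⟨ cong ([ distinct l ] ·_) (insert-descents (λ x → [ x + 1 ≡ᵇ k ]) l) ⟩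
        [ distinct l ] · (suc d · [ d + 1 ≡ᵇ k ] + (m ∸ d) · [ suc d + 1 ≡ᵇ k ])
      ≡⟨ cong (λ w → [ distinct l ] · (w + (m ∸ d) · [ suc d + 1 ≡ᵇ k ]))
              (trans (cong (_· [ d + 1 ≡ᵇ k ]) (ℕP.+-comm 1 d)) (bracket-at (λ y → y) (d + 1) k)) ⟩
        [ distinct l ] · (k · [ d + 1 ≡ᵇ k ] + (m ∸ d) · [ suc d + 1 ≡ᵇ k ])
      ≡⟨ distribute [ distinct l ] k _ _ ⟩
        k · onDistinct (hasDes k) l + new l ∎
      where d = desList l
    new-total : ∀ j → wsum m n (λ l → [ distinct l ] · ((m ∸ desList l) · [ suc (desList l) + 1 ≡ᵇ j ]))
                      ≡ raised m n j
    new-total zero    = wsum-zero m n (λ l _ →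
      trans (cong ([ distinct l ] ·_) (ℕP.*-zeroʳ (m ∸ desList l))) (ℕP.*-zeroʳ [ distinct l ]))
    new-total (suc j) =
      trans (wsum-cong m n (λ l _ → trans (cong ([ distinct l ] ·_) (at-j l))
                                          (swap [ distinct l ] (suc m ∸ j) _)))
            (wsum-* m n (suc m ∸ j) (onDistinct (hasDes j)))
      where
      swap : ∀ x y z → x · (y · z) ≡ y · (x · z)
      swap = solve-∀
      at-j : ∀ l → (m ∸ desList l) · [ desList l + 1 ≡ᵇ j ] ≡ (suc m ∸ j) · [ desList l + 1 ≡ᵇ j ]
      at-j l = trans (cong (λ y → (suc m ∸ y) · [ desList l + 1 ≡ᵇ j ]) (ℕP.+-comm 1 (desList l)))
                     (bracket-at (suc m ∸_) (desList l + 1) j)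

  -- count m n k = C(n,m) · e m k: choose the m letters, then order them.
  count-binomial : ∀ m n k → count m n k ≡ (n C m) · e m k
  count-binomial zero    n       k       = refl
  count-binomial (suc m) zero    k       = wsum-zero m 0 (λ _ _ → refl)
  count-binomial (suc m) (suc n) zero    =
    trans (count-step m n zero)
          (trans (cong (λ c → c + (0 · count m n 0 + 0)) (count-binomial (suc m) n zero))
                 (vanish (n C suc m) (suc n C suc m)))
    where
    vanish : ∀ a b → a · 0 + 0 ≡ b · 0
    vanish = solve-∀
  count-binomial (suc m) (suc n) (suc k) = begin
      count (suc m) (suc n) (suc k)
    ≡⟨ count-step m n (suc k) ⟩
      count (suc m) n (suc k) + (suc k · count m n (suc k) + (suc m ∸ k) · count m n k)
    ≡⟨ cong₂ (λ x y → x + (suc k · y + (suc m ∸ k) · count m n k))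
             (count-binomial (suc m) n (suc k)) (count-binomial m n (suc k)) ⟩
      (n C suc m) · e (suc m) (suc k) + (suc k · ((n C m) · e m (suc k)) + (suc m ∸ k) · count m n k)
    ≡⟨ cong (λ z → (n C suc m) · e (suc m) (suc k) + (suc k · ((n C m) · e m (suc k)) + (suc m ∸ k) · z))
            (count-binomial m n k) ⟩
      (n C suc m) · e (suc m) (suc k) + (suc k · ((n C m) · e m (suc k)) + (suc m ∸ k) · ((n C m) · e m k))
    ≡⟨ factor (n C suc m) (n C m) (suc k) (e m (suc k)) (suc m ∸ k) (e m k) ⟩
      ((n C m) + (n C suc m)) · e (suc m) (suc k)
    ≡⟨ cong (_· e (suc m) (suc k)) (nCk+nC[k+1]≡[n+1]C[k+1] n m) ⟩
      (suc n C suc m) · e (suc m) (suc k) ∎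
    where
    open ≡-Reasoning
    factor : ∀ A B k x y w → A · (k · x + y · w) + (k · (B · x) + y · (B · w))
                             ≡ (B + A) · (k · x + y · w)
    factor = solve-∀

module Enumeration where
  open import Data.Nat using (zero; suc; _+_) renaming (_*_ to _·_)
  import Data.Nat.Properties as ℕP
  open import Data.Nat.ListAction using (sum)
  open import Data.Nat.ListAction.Properties using (sum-++)
  open import Data.Nat.Combinatorics using (_C_; nCn≡1)
  open import Data.Fin as Fin using (Fin; toℕ)
  open import Data.Vec using (Vec; toList) renaming (_∷_ to _∷ᵥ_)
  open import Data.List as List using (List; []; _∷_; map; concatMap; filter; length)
  import Data.List.Properties as ListP
  open import Data.Bool using (true; false)
  import Data.Bool as Bool
  open import Relation.Nullary.Decidable using (does)
  open import Relation.Unary using (Decidable)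
  open import Relation.Binary.PropositionalEquality using (refl; trans; cong; cong₂; module ≡-Reasoning)
  open WordSums
  open Insertion
  open DescentCounts

  letters : ∀ {m n} → Vec (Fin n) m → List ℕ
  letters w = map toℕ (toList w)

  sum-concatMap : ∀ {A B : Set} (G : A → ℕ) (h : B → List A) xs →
    sum (map G (concatMap h xs)) ≡ sum (map (λ x → sum (map G (h x))) xs)
  sum-concatMap G h []       = refl
  sum-concatMap G h (x ∷ xs) =
    trans (cong sum (ListP.map-++ G (h x) (concatMap h xs)))
          (trans (sum-++ (map G (h x)) (map G (concatMap h xs)))
                 (cong (λ s → sum (map G (h x)) + s) (sum-concatMap G h xs)))

  sum-tabulate : ∀ {X : Set} n (g : Fin n → X) (P : X → ℕ) (G : ℕ → ℕ) →
    (∀ i → P (g i) ≡ G (toℕ i)) →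
    sum (map P (List.tabulate g)) ≡ σ n G
  sum-tabulate zero    g P G P∘g≗G = refl
  sum-tabulate (suc n) g P G P∘g≗G =
    cong₂ _+_ (P∘g≗G Fin.zero)
              (sum-tabulate n (λ i → g (Fin.suc i)) P (λ j → G (suc j)) (λ i → P∘g≗G (Fin.suc i)))

  wsum-allWords : ∀ m n F → sum (map (λ w → F (letters w)) (allWords m n)) ≡ wsum m n F
  wsum-allWords zero    n F = ℕP.+-identityʳ (F [])
  wsum-allWords (suc m) n F =
    trans (sum-concatMap (λ w → F (letters w)) _ (allWords m n))
          (trans (cong sum (ListP.map-cong first-letter (allWords m n)))
                 (wsum-allWords m n (λ l → σ n (λ j → F (j ∷ l)))))
    where
    first-letter : ∀ (w : Vec (Fin n) m) →
      sum (map (λ v → F (letters v)) (map (_∷ᵥ w) (List.allFin n))) ≡ σ n (λ j → F (j ∷ letters w))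
    first-letter w =
      trans (cong (λ vs → sum (map (λ v → F (letters v)) vs)) (ListP.map-tabulate (λ i → i) (_∷ᵥ w)))
            (sum-tabulate n (_∷ᵥ w) (λ v → F (letters v)) (λ j → F (j ∷ letters w)) (λ i → refl))

  length-filter² : ∀ {A : Set} {P Q : A → Set} (P? : Decidable P) (Q? : Decidable Q) xs →
    length (filter P? (filter Q? xs)) ≡ sum (map (λ x → [ does (Q? x) ] · [ does (P? x) ]) xs)
  length-filter² P? Q? []       = refl
  length-filter² P? Q? (x ∷ xs) with does (Q? x)
  ... | false = length-filter² P? Q? xs
  ... | true with does (P? x)
  ...   | true  = cong suc (length-filter² P? Q? xs)
  ...   | false = length-filter² P? Q? xs

  is-true : ∀ b → [ does (b Bool.≟ true) ] ≡ [ b ]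
  is-true true  = refl
  is-true false = refl

  eulerian-coeff : ∀ n k → Eulerian (suc n) k ≡ + e (suc n) k
  eulerian-coeff n k = cong +_ (begin
      length (filter _ (perms (suc n)))
    ≡⟨ length-filter² _ _ (allWords (suc n) (suc n)) ⟩
      sum (map (λ w → [ does (distinct (letters w) Bool.≟ true) ] · hasDes k (letters w))
               (allWords (suc n) (suc n)))
    ≡⟨ cong sum (ListP.map-cong (λ w → cong (_· hasDes k (letters w)) (is-true (distinct (letters w))))
                                (allWords (suc n) (suc n))) ⟩
      sum (map (λ w → onDistinct (hasDes k) (letters w)) (allWords (suc n) (suc n)))
    ≡⟨ wsum-allWords (suc n) (suc n) (onDistinct (hasDes k)) ⟩
      count (suc n) (suc n) k
    ≡⟨ count-binomial (suc n) (suc n) k ⟩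
      (suc n C suc n) · e (suc n) k
    ≡⟨ trans (cong (_· e (suc n) k) (nCn≡1 (suc n))) (ℕP.*-identityˡ _) ⟩
      e (suc n) k ∎)
    where open ≡-Reasoning

module EulerianRecurrence where
  open import Data.Nat as ℕ using (zero; suc; _∸_)
  import Data.Nat.Properties as ℕP
  open import Data.Integer using (ℤ; _+_; _-_)
  import Data.Integer.Properties as ℤP
  open import Data.Integer.Tactic.RingSolver using (solve-∀)
  open import Relation.Binary.PropositionalEquality using (refl; sym; trans; cong; cong₂; module ≡-Reasoning)
  open import Relation.Nullary using (yes; no)
  open RecurrenceOperator
  open DescentCounts using (e; e-vanishes)
  open Enumeration using (eulerian-coeff)

  -- the truncated factor (M+1) ∸ k of the recurrence for e is exact wherever e M k ≠ 0
  truncated-factor : ∀ M k → + (suc M ∸ k) * + e M k ≡ (+ suc M - + k) * + e M k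
  truncated-factor M k with k ℕP.≤? suc M
  ... | yes k≤M+1 = cong (_* + e M k) (sym (trans (ℤP.m-n≡m⊖n (suc M) k) (ℤP.⊖-≥ k≤M+1)))
  ... | no  k≰M+1 rewrite e-vanishes M k (ℕP.≰⇒> k≰M+1) =
    trans (ℤP.*-zeroʳ (+ (suc M ∸ k))) (sym (ℤP.*-zeroʳ (+ suc M - + k)))

  e-step : ∀ m d → + 2 * + e (suc m) d ≡ R (+ (2 ℕ.* suc m)) (λ j → + e m j) d
  e-step m zero    = sym (R-zero (+ (2 ℕ.* suc m)) (λ j → + e m j))
  e-step m (suc k) = begin
      + 2 * + (suc k ℕ.* e m (suc k) ℕ.+ (suc m ∸ k) ℕ.* e m k)
    ≡⟨ cong (+ 2 *_) (trans (ℤP.pos-+ (suc k ℕ.* e m (suc k)) _)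
                            (cong₂ _+_ (ℤP.pos-* (suc k) (e m (suc k))) (ℤP.pos-* (suc m ∸ k) (e m k)))) ⟩
      + 2 * (+ suc k * + e m (suc k) + + (suc m ∸ k) * + e m k)
    ≡⟨ cong (λ t → + 2 * (+ suc k * + e m (suc k) + t)) (truncated-factor m k) ⟩
      + 2 * (+ suc k * + e m (suc k) + (+ suc m - + k) * + e m k)
    ≡⟨ rearrange (+ suc k) (+ k) (+ suc m) (+ e m (suc k)) (+ e m k) ⟩
      ((+ 2 * + suc m) * + e m k + + 2 * (+ suc k * + e m (suc k))) - + 2 * (+ k * + e m k)
    ≡⟨ cong (λ c → (c * + e m k + + 2 * (+ suc k * + e m (suc k))) - + 2 * (+ k * + e m k))
            (sym (ℤP.pos-* 2 (suc m))) ⟩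
      ((+ (2 ℕ.* suc m)) * + e m k + + 2 * (+ suc k * + e m (suc k))) - + 2 * (+ k * + e m k)
    ≡⟨ R-suc (+ (2 ℕ.* suc m)) (λ j → + e m j) k ⟨
      R (+ (2 ℕ.* suc m)) (λ j → + e m j) (suc k) ∎
    where
    open ≡-Reasoning
    rearrange : ∀ s K M E₁ E₀ → + 2 * (s * E₁ + (M - K) * E₀)
                                ≡ ((+ 2 * M) * E₀ + + 2 * (s * E₁)) - + 2 * (K * E₀)
    rearrange = solve-∀

  -- E_0 = x and A_0 = 1 have the same image 2x under R_2
  R₂-base : ∀ d → R (+ 2) (λ j → + e 0 j) d ≡ R (+ 2) one d
  R₂-base zero                = refl
  R₂-base (suc zero)          = refl
  R₂-base (suc (suc zero))    = refl
  R₂-base (suc (suc (suc i))) = refl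

  rhs-step : ∀ n d → + (2 ^ suc n) * Eulerian (suc n) d
                     ≡ R (+ (2 ℕ.* suc n)) (λ j → + (2 ^ n) * Eulerian n j) d
  rhs-step zero    d = begin
      + 2 * Eulerian 1 d
    ≡⟨ cong (+ 2 *_) (eulerian-coeff 0 d) ⟩
      + 2 * + e 1 d
    ≡⟨ e-step 0 d ⟩
      R (+ 2) (λ j → + e 0 j) d
    ≡⟨ R₂-base d ⟩
      R (+ 2) one d
    ≡⟨ R-cong (+ 2) (λ j → sym (ℤP.*-identityˡ (one j))) d ⟩
      R (+ 2) (λ j → + 1 * one j) d ∎
    where open ≡-Reasoning
  rhs-step (suc m) d = begin
      + (2 ^ suc (suc m)) * Eulerian (suc (suc m)) d
    ≡⟨ cong₂ _*_ (ℤP.pos-* 2 (2 ^ suc m)) (eulerian-coeff (suc m) d) ⟩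
      (+ 2 * + (2 ^ suc m)) * + e (suc (suc m)) d
    ≡⟨ swap (+ 2) (+ (2 ^ suc m)) (+ e (suc (suc m)) d) ⟩
      + (2 ^ suc m) * (+ 2 * + e (suc (suc m)) d)
    ≡⟨ cong (+ (2 ^ suc m) *_) (e-step (suc m) d) ⟩
      + (2 ^ suc m) * R c (λ j → + e (suc m) j) d
    ≡⟨ R-scale (+ (2 ^ suc m)) c (λ j → + e (suc m) j) d ⟩
      R c (λ j → + (2 ^ suc m) * + e (suc m) j) d
    ≡⟨ R-cong c (λ j → cong (+ (2 ^ suc m) *_) (sym (eulerian-coeff m j))) d ⟩
      R c (λ j → + (2 ^ suc m) * Eulerian (suc m) j) d ∎
    where
    open ≡-Reasoning
    c : ℤ
    c = + (2 ℕ.* suc (suc m))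
    swap : ∀ a b x → (a * b) * x ≡ b * (a * x)
    swap = solve-∀

open import Data.Nat as ℕ using (zero; suc)
open import Relation.Binary.PropositionalEquality using (cong; module ≡-Reasoning)
open PolynomialAlgebra using (⊗-identityˡ)
open RecurrenceOperator using (R; R-cong)
open ConvolutionRecurrence using (lhs-step)
open EulerianRecurrence using (rhs-step)

mainTheorem9 : (n : ℕ) → (d : ℕ) → lhsPoly n d ≡ + (2 ^ n) * Eulerian n d
mainTheorem9 zero    d = cong (+ 1 *_) (⊗-identityˡ one d)
mainTheorem9 (suc n) d = begin
    lhsPoly (suc n) d
  ≡⟨ lhs-step n d ⟩
    R (+ (2 ℕ.* suc n)) (lhsPoly n) d
  ≡⟨ R-cong (+ (2 ℕ.* suc n)) (mainTheorem9 n) d ⟩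
    R (+ (2 ℕ.* suc n)) (λ j → + (2 ^ n) * Eulerian n j) d
  ≡⟨ rhs-step n d ⟨
    + (2 ^ suc n) * Eulerian (suc n) d ∎
  where open ≡-Reasoning
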